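{- Let $G=(V_1\cup V_2,E)$ be a bipartite graph with a fixed bipartition and let $k$ be a positive integer. Let $R$ be a twin class of $G$, let $T$ be the set of sisters of $R$, and let $W = N(N(R))\setminus (R\cup T)$. Suppose that $|R|>|W|$ and $|T|\ge 1$. Let $t\in T$ and let $v$ be the unique vertex of $N(t)\setminus N(R)$. Then $G$ admits a biclustering of cost at most $k$ if and only if $G - tv$ admits a biclustering of cost at most $k-1$.
   Context: $N(x)$ denotes the neighborhood of $x$; for a set $X$ of vertices on one side, $N(X)=\bigcup_{x\in X}N(x)$. Two vertices on the same side are twins if they have the same neighborhood; a twin class is an equivalence class of this relation (possibly a single vertex). Given a twin class $R$, with $S=N(R)$, a vertex $t\in N(S)\setminus R$ is a sister of $R$ if (i) $t$ has no twin in $G$ (i.e. $\{t\}$ is a twin class) and (ii) $N(t)=S\cup\{v\}$ for some vertex $v\notin S$. A bicluster is a set $X\cup Y$ with $X\subseteq V_1$, $Y\subseteq V_2$ such that $N(x)=Y$ for all $x\in X$ and $N(y)=X$ for all $y\in Y$ (an isolated vertex is a bicluster); a bicluster graph is a graph each of whose connected components is a bicluster. A biclustering of $G$ is a bicluster graph $\mathcal{B}$ with $V(\mathcal{B})=V(G)$ all of whose edges have one endpoint in $V_1$ and one in $V_2$; its cost is $|E(G)\triangle E(\mathcal{B})|$. $G-tv$ is the graph obtained from $G$ by deleting the edge $tv$. -}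

module Defs where

open import Data.Nat using (ℕ; _≤_; _<_; _∸_)
open import Data.Bool using (Bool; true; false; _∧_; _∨_; not; _xor_; if_then_else_)
open import Data.Fin using (Fin)
import Data.Fin.Properties as FinP
open import Data.Sum using (_⊎_; inj₁; inj₂)
open import Data.Sum.Properties using (≡-dec)
open import Data.List using (List; map; _++_; allFin)
open import Data.Nat.ListAction using (sum)
open import Data.Bool.ListAction using (all; any)
open import Data.Product using (Σ; _×_)
open import Function.Bundles using (_⇔_)
open import Relation.Binary.PropositionalEquality using (_≡_)
open import Relation.Nullary.Decidable using (⌊_⌋)

-- A bipartite graph with fixed bipartition V₁ = Fin n₁, V₂ = Fin n₂,
-- given by its (bipartite) adjacency matrix: G x y = true iff xy ∈ E.
BipGraph : ℕ → ℕ → Set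
BipGraph n₁ n₂ = Fin n₁ → Fin n₂ → Bool

Vertex : ℕ → ℕ → Set
Vertex n₁ n₂ = Fin n₁ ⊎ Fin n₂

module _ {n₁ n₂ : ℕ} where

  _≟V_ : (u w : Vertex n₁ n₂) → Bool
  u ≟V w = ⌊ ≡-dec FinP._≟_ FinP._≟_ u w ⌋

  vertices : List (Vertex n₁ n₂)
  vertices = map inj₁ (allFin n₁) ++ map inj₂ (allFin n₂)

  card : (Vertex n₁ n₂ → Bool) → ℕ
  card P = sum (map (λ u → if P u then 1 else 0) vertices)

  _==_ : Bool → Bool → Bool
  a == b = not (a xor b)

  adj : BipGraph n₁ n₂ → Vertex n₁ n₂ → Vertex n₁ n₂ → Bool
  adj G (inj₁ x) (inj₂ y) = G x y
  adj G (inj₂ y) (inj₁ x) = G x y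
  adj G (inj₁ _) (inj₁ _) = false
  adj G (inj₂ _) (inj₂ _) = false

  sameSide : Vertex n₁ n₂ → Vertex n₁ n₂ → Bool
  sameSide (inj₁ _) (inj₁ _) = true
  sameSide (inj₂ _) (inj₂ _) = true
  sameSide _ _ = false

  twin : BipGraph n₁ n₂ → Vertex n₁ n₂ → Vertex n₁ n₂ → Bool
  twin G x y = sameSide x y ∧ all (λ z → adj G x z == adj G y z) vertices

  inR : BipGraph n₁ n₂ → Vertex n₁ n₂ → Vertex n₁ n₂ → Bool
  inR G r x = twin G r x

  inS : BipGraph n₁ n₂ → Vertex n₁ n₂ → Vertex n₁ n₂ → Bool
  inS G r z = any (λ x → inR G r x ∧ adj G x z) vertices

  inNS : BipGraph n₁ n₂ → Vertex n₁ n₂ → Vertex n₁ n₂ → Bool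
  inNS G r t = any (λ z → inS G r z ∧ adj G z t) vertices

  noTwin : BipGraph n₁ n₂ → Vertex n₁ n₂ → Bool
  noTwin G t = all (λ u → not (twin G t u) ∨ (u ≟V t)) vertices

  sister : BipGraph n₁ n₂ → Vertex n₁ n₂ → Vertex n₁ n₂ → Bool
  sister G r t =
    inNS G r t ∧ not (inR G r t) ∧ noTwin G t ∧
    any (λ v → not (inS G r v) ∧
               all (λ z → adj G t z == (inS G r z ∨ (z ≟V v))) vertices)
        vertices

  inT : BipGraph n₁ n₂ → Vertex n₁ n₂ → Vertex n₁ n₂ → Bool
  inT G r t = sister G r t

  inW : BipGraph n₁ n₂ → Vertex n₁ n₂ → Vertex n₁ n₂ → Bool
  inW G r x = inNS G r x ∧ not (inR G r x) ∧ not (inT G r x)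

  deleteEdge : BipGraph n₁ n₂ → Vertex n₁ n₂ → Vertex n₁ n₂ → BipGraph n₁ n₂
  deleteEdge G a b x y =
    G x y ∧ not (((inj₁ x ≟V a) ∧ (inj₂ y ≟V b)) ∨ ((inj₁ x ≟V b) ∧ (inj₂ y ≟V a)))

  data Reach (B : BipGraph n₁ n₂) : Vertex n₁ n₂ → Vertex n₁ n₂ → Set where
    here : ∀ u → Reach B u u
    step : ∀ {u w z} → Reach B u w → adj B w z ≡ true → Reach B u z

  -- every connected component (the component of u, with X = C ∩ V₁,
  -- Y = C ∩ V₂) is a bicluster: N(x) = Y for x ∈ X, N(y) = X for y ∈ Y
  IsBiclusterGraph : BipGraph n₁ n₂ → Set
  IsBiclusterGraph B = ∀ u →
    (∀ x y → Reach B u (inj₁ x) → (B x y ≡ true ⇔ Reach B u (inj₂ y))) ×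
    (∀ x y → Reach B u (inj₂ y) → (B x y ≡ true ⇔ Reach B u (inj₁ x)))

  cost : BipGraph n₁ n₂ → BipGraph n₁ n₂ → ℕ
  cost G B = sum (map (λ x → sum (map (λ y → if G x y xor B x y then 1 else 0)
                                       (allFin n₂))) (allFin n₁))

  HasBiclustering : BipGraph n₁ n₂ → ℕ → Set
  HasBiclustering G k =
    Σ (BipGraph n₁ n₂) (λ B → IsBiclusterGraph B × cost G B ≤ k)

module Submission where

-- Deleting tv changes the cost of a biclustering by exactly one if the biclustering avoids tv
-- and by at most one otherwise, so it suffices to turn every biclustering B containing tv into
-- one avoiding tv at no extra cost.  Let r* ∈ R have the cheapest row in B, let Y be its
-- cluster and q = |S △ Y| its cost, where S = N(R).
--  * v ∈ Y: split the cluster of Y along S; R and the rows of N(S) in it get Y ∩ S, the other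
--    rows Y ∖ S.  Every twin saves a = |Y ∖ S| ≥ 1, every vertex of W loses at most a, t loses
--    at most 2 − a, and the other sisters lose nothing (a sister with extra neighbour v' ∈ Y
--    forces a ≥ 2, since v' ≠ v because sisters have no twins).  |R| > |W| pays for it.
--  * v ∉ Y and t costs more than q: move t into the cluster of r*; it then costs at most q + 1.
--  * v ∉ Y and t costs at most q: make R ∪ T ∪ S a bicluster and remove S from all other
--    clusters.  Every twin saves at least q ≥ 1, every vertex of W loses at most q, every sister
--    costs at most 1 afterwards, and at most one sister was exact before (two would be twins).
-- If R lies in V₂ the argument is applied to the transposed graph.

open import Defs
open import Data.Bool using (Bool; true; false; _∧_; _∨_; not; _xor_; if_then_else_)
import Data.Bool.Properties as Bool
open import Data.Bool.ListAction using (any; all; and; or)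
open import Data.Empty using (⊥; ⊥-elim)
open import Data.Fin using (Fin; zero; suc; _≟_)
open import Data.Fin.Properties using (any?)
open import Data.List using (map; _++_; allFin; tabulate)
open import Data.List.Membership.Propositional using (_∈_; lose)
open import Data.List.Membership.Propositional.Properties using (∈-++⁺ˡ; ∈-++⁺ʳ; ∈-map⁺; ∈-allFin)
open import Data.List.Properties using (map-tabulate; map-cong; map-++; map-∘)
import Data.List.Relation.Unary.All as All
open import Data.List.Relation.Unary.All.Properties using (all⁺; all⁻)
import Data.List.Relation.Unary.Any as Any
open import Data.List.Relation.Unary.Any.Properties using (any⁺; any⁻)
open import Data.Nat as ℕ using (ℕ; zero; suc; _+_; _*_; _∸_; _≤_; _<_; z≤n; s≤s; _<?_)
open import Data.Nat.Induction using (<-wellFounded)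
import Data.Nat.ListAction as List
open import Data.Nat.ListAction.Properties using (sum-++)
open import Data.Nat.Properties
  using ( +-*-semiring; ≤-refl; ≤-trans; ≤-reflexive; +-mono-≤; +-monoˡ-≤; +-monoʳ-≤; +-cancelˡ-≤
        ; +-comm; +-assoc; +-identityʳ; *-identityˡ; *-identityʳ; *-zeroʳ; *-suc; *-monoʳ-≤
        ; m≤m+n; m≤n+m; n≤0⇒n≡0; n≢0⇒n>0; ≮⇒≥; m+n≤o⇒m≤o∸n; m∸n+n≡m; module ≤-Reasoning)
open import Algebra.Properties.Semiring.Sum +-*-semiring using (sum; ∑-distrib-+; ∑-comm; *-distribˡ-sum; sum-cong-≗)
open import Data.Product using (∃-syntax; ∄-syntax; _×_; _,_; proj₁; proj₂)
open import Data.Sum using (_⊎_; inj₁; inj₂; swap)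
open import Data.Sum.Properties using (swap-involutive)
open import Function using (_∘_)
open import Function.Bundles using (_⇔_; mk⇔; Equivalence)
open import Induction.WellFounded using (Acc; acc)
open import Relation.Binary.PropositionalEquality
  using (_≡_; _≢_; _≗_; refl; sym; trans; cong; cong₂; subst; subst₂; module ≡-Reasoning)
open import Relation.Nullary using (yes; no; does)
open import Relation.Nullary.Decidable using (_×-dec_)

-- Finite sums and counting

⟦_⟧ : Bool → ℕ
⟦ b ⟧ = if b then 1 else 0

count : ∀ {n} → (Fin n → Bool) → ℕ
count P = sum (λ i → ⟦ P i ⟧)

_≡ᵇ_ : ∀ {n} → Fin n → Fin n → Bool
i ≡ᵇ j = does (i ≟ j)

≡ᵇ-refl : ∀ {n} (i : Fin n) → (i ≡ᵇ i) ≡ true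
≡ᵇ-refl i with i ≟ i
... | yes _   = refl
... | no i≢i = ⊥-elim (i≢i refl)

≡ᵇ⇒≡ : ∀ {n} {i j : Fin n} → (i ≡ᵇ j) ≡ true → i ≡ j
≡ᵇ⇒≡ {i = i} {j} _ with i ≟ j
≡ᵇ⇒≡ _ | yes i≡j = i≡j

sum-mono-≤ : ∀ {n} {f g : Fin n → ℕ} → (∀ i → f i ≤ g i) → sum f ≤ sum g
sum-mono-≤ {zero}  _   = z≤n
sum-mono-≤ {suc n} f≤g = +-mono-≤ (f≤g zero) (sum-mono-≤ (f≤g ∘ suc))

sum-zero : ∀ n → sum {n} (λ _ → 0) ≡ 0
sum-zero zero    = refl
sum-zero (suc n) = sum-zero n

term≤sum : ∀ {n} (f : Fin n → ℕ) i → f i ≤ sum f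
term≤sum f zero    = m≤m+n _ _
term≤sum f (suc i) = ≤-trans (term≤sum (f ∘ suc) i) (m≤n+m _ _)

term+term≤sum : ∀ {n} (f : Fin n → ℕ) {i j} → i ≢ j → f i + f j ≤ sum f
term+term≤sum f {zero}  {zero}  i≢j = ⊥-elim (i≢j refl)
term+term≤sum f {zero}  {suc j} _   = +-monoʳ-≤ (f zero) (term≤sum (f ∘ suc) j)
term+term≤sum f {suc i} {zero}  _   =
  subst (_≤ sum f) (+-comm (f zero) (f (suc i))) (+-monoʳ-≤ (f zero) (term≤sum (f ∘ suc) i))
term+term≤sum f {suc i} {suc j} i≢j =
  ≤-trans (term+term≤sum (f ∘ suc) (i≢j ∘ cong suc)) (m≤n+m _ _)

sum≡0⇒term≡0 : ∀ {n} (f : Fin n → ℕ) → sum f ≡ 0 → ∀ i → f i ≡ 0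
sum≡0⇒term≡0 f sum≡0 i = n≤0⇒n≡0 (subst (f i ≤_) sum≡0 (term≤sum f i))

count-≡ᵇ : ∀ {n} (j : Fin n) → count (_≡ᵇ j) ≡ 1
count-≡ᵇ {suc n} zero    = cong suc (sum-zero n)
count-≡ᵇ {suc n} (suc j) = trans (sum-cong-≗ λ i → cong ⟦_⟧ (suc≡ᵇsuc i)) (count-≡ᵇ j)
  where
  suc≡ᵇsuc : ∀ i → (suc i ≡ᵇ suc j) ≡ (i ≡ᵇ j)
  suc≡ᵇsuc i with i ≟ j
  ... | yes _ = refl
  ... | no  _ = refl

count≤1 : ∀ {n} (P : Fin n → Bool) → (∀ i j → P i ≡ true → P j ≡ true → i ≡ j) → count P ≤ 1
count≤1 {n} P unique with any? (λ i → P i Bool.≟ true)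
... | yes (i , Pi) = subst (count P ≤_) (count-≡ᵇ i) (sum-mono-≤ at-most-at-i)
  where
  at-most-at-i : ∀ k → ⟦ P k ⟧ ≤ ⟦ k ≡ᵇ i ⟧
  at-most-at-i k with P k in Pk
  ... | false = z≤n
  ... | true  = ≤-reflexive (cong ⟦_⟧ (sym (subst (λ j → (k ≡ᵇ j) ≡ true) (unique k i Pk Pi) (≡ᵇ-refl k))))
... | no ∄i = ≤-trans (sum-mono-≤ {g = λ _ → 0} nowhere) (subst (_≤ 1) (sym (sum-zero n)) z≤n)
  where
  nowhere : ∀ k → ⟦ P k ⟧ ≤ 0
  nowhere k with P k in Pk
  ... | false = z≤n
  ... | true  = ⊥-elim (∄i (k , Pk))

when : Bool → ℕ → ℕ
when b c = if b then c else 0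

sum-when : ∀ {n} (P : Fin n → Bool) c → sum (λ i → when (P i) c) ≡ c * count P
sum-when P c = sym (trans (*-distribˡ-sum c (λ i → ⟦ P i ⟧)) (sum-cong-≗ scale))
  where
  scale : ∀ i → c * ⟦ P i ⟧ ≡ when (P i) c
  scale i with P i
  ... | true  = *-identityʳ c
  ... | false = *-zeroʳ c

sum-when-+ : ∀ {n} (P : Fin n → Bool) c (f : Fin n → ℕ) →
             sum (λ i → when (P i) c + f i) ≡ c * count P + sum f
sum-when-+ P c f = trans (∑-distrib-+ (λ i → when (P i) c) f) (cong (_+ sum f) (sum-when P c))

sum-when-when-+ : ∀ {n} (P Q : Fin n → Bool) c c' (f : Fin n → ℕ) →
                 sum (λ i → when (P i) c + (when (Q i) c' + f i)) ≡ c * count P + (c' * count Q + sum f)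
sum-when-when-+ P Q c c' f =
  trans (sum-when-+ P c (λ i → when (Q i) c' + f i)) (cong (c * count P +_) (sum-when-+ Q c' f))

weighted-cancel : ∀ a e f {w ρ} c c' → f ≤ e + a → w < ρ →
                  e + (a * ρ + c') ≤ f + (a * w + c) → c' ≤ c
weighted-cancel a e f {w} {ρ} c c' f≤e+a w<ρ le = +-cancelˡ-≤ (f + a * w) c' c (begin
  f + a * w + c'       ≤⟨ +-monoˡ-≤ c' (+-monoˡ-≤ (a * w) f≤e+a) ⟩
  e + a + a * w + c'   ≡⟨ cong (_+ c') (trans (+-assoc e a (a * w)) (cong (e +_) (sym (*-suc a w)))) ⟩
  e + a * suc w + c'   ≤⟨ +-monoˡ-≤ c' (+-monoʳ-≤ e (*-monoʳ-≤ a w<ρ)) ⟩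
  e + a * ρ + c'       ≡⟨ +-assoc e (a * ρ) c' ⟩
  e + (a * ρ + c')     ≤⟨ le ⟩
  f + (a * w + c)      ≡⟨ +-assoc f (a * w) c ⟨
  f + a * w + c        ∎)
  where open ≤-Reasoning

minimiser : ∀ {n} (P : Fin n → Bool) (f : Fin n → ℕ) i → P i ≡ true →
            ∃[ j ] P j ≡ true × (∀ k → P k ≡ true → f j ≤ f k)
minimiser P f i Pi = go i Pi (<-wellFounded (f i))
  where
  go : ∀ i → P i ≡ true → Acc _<_ (f i) → ∃[ j ] P j ≡ true × (∀ k → P k ≡ true → f j ≤ f k)
  go i Pi (acc smaller) with any? (λ k → (P k Bool.≟ true) ×-dec (f k <? f i))
  ... | yes (k , Pk , fk<fi) = go k Pk (smaller fk<fi)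
  ... | no  ∄smaller        = i , Pi , λ k Pk → ≮⇒≥ (λ fk<fi → ∄smaller (k , Pk , fk<fi))

-- Boolean rows

∧≡true⇒ : ∀ {a b} → a ∧ b ≡ true → a ≡ true × b ≡ true
∧≡true⇒ {true} {true} _ = refl , refl

∖≡true⇒ : ∀ {a b} → a ∧ not b ≡ true → a ≡ true × b ≡ false
∖≡true⇒ {true} {false} _ = refl , refl

≡ᵇ0⇒≡0 : ∀ {c} → (c ℕ.≡ᵇ 0) ≡ true → c ≡ 0
≡ᵇ0⇒≡0 {zero} _ = refl

1≤⟦≡ᵇ0⟧+ : ∀ c → 1 ≤ ⟦ c ℕ.≡ᵇ 0 ⟧ + c
1≤⟦≡ᵇ0⟧+ zero    = s≤s z≤n
1≤⟦≡ᵇ0⟧+ (suc c) = s≤s z≤n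

mismatch : Bool → Bool → ℕ
mismatch a b = ⟦ a xor b ⟧

module _ {m : ℕ} where

  _∩_ _∖_ : (Fin m → Bool) → (Fin m → Bool) → Fin m → Bool
  (P ∩ Q) y = P y ∧ Q y
  (P ∖ Q) y = P y ∧ not (Q y)

  hamming : (Fin m → Bool) → (Fin m → Bool) → ℕ
  hamming P Q = sum (λ y → mismatch (P y) (Q y))

  meets : (Fin m → Bool) → (Fin m → Bool) → Bool
  meets P Q = does (any? λ y → (P ∩ Q) y Bool.≟ true)

  meets-intro : ∀ {P Q} y → (P ∩ Q) y ≡ true → meets P Q ≡ true
  meets-intro {P} {Q} y PQy with any? (λ y → (P ∩ Q) y Bool.≟ true)
  ... | yes _ = refl
  ... | no ∄  = ⊥-elim (∄ (y , PQy))

  meets-witness : ∀ {P Q} → meets P Q ≡ true → ∃[ y ] P y ≡ true × Q y ≡ true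
  meets-witness {P} {Q} _ with any? (λ y → (P ∩ Q) y Bool.≟ true)
  ... | yes (y , PQy) = y , ∧≡true⇒ PQy

  meets-false : ∀ {P Q} → meets P Q ≡ false → ∀ y → P y ≡ true → Q y ≡ false
  meets-false {P} {Q} _ y Py with any? (λ y → (P ∩ Q) y Bool.≟ true) | Q y in Qy
  ... | no ∄ | true  = ⊥-elim (∄ (y , cong₂ _∧_ Py Qy))
  ... | no ∄ | false = refl

mismatch-self : ∀ a → mismatch a a ≡ 0
mismatch-self true  = refl
mismatch-self false = refl

mismatch≡0⇒≡ : ∀ a b → mismatch a b ≡ 0 → a ≡ b
mismatch≡0⇒≡ true  true  _ = refl
mismatch≡0⇒≡ false false _ = refl

mismatch-∩-split : ∀ s y → ⟦ y ∧ not s ⟧ + mismatch s (y ∧ s) ≡ mismatch s y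
mismatch-∩-split true  true  = refl
mismatch-∩-split true  false = refl
mismatch-∩-split false true  = refl
mismatch-∩-split false false = refl

mismatch-∩ : ∀ g s y → mismatch g (y ∧ s) ≤ ⟦ y ∧ not s ⟧ + mismatch g y
mismatch-∩ g     true  y     rewrite Bool.∧-identityʳ y | Bool.∧-zeroʳ y = ≤-refl
mismatch-∩ true  false true  = s≤s z≤n
mismatch-∩ true  false false = s≤s z≤n
mismatch-∩ false false true  = z≤n
mismatch-∩ false false false = z≤n

mismatch-∖ : ∀ g s b → mismatch g (b ∧ not s) ≤ ⟦ b ∧ s ⟧ + mismatch g b
mismatch-∖ g s b = subst (λ s' → mismatch g (b ∧ not s) ≤ ⟦ b ∧ s' ⟧ + mismatch g b)
                         (Bool.not-involutive s) (mismatch-∩ g (not s) b)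

mismatch-∖-disjoint : ∀ g s y → (s ≡ true → g ≡ false) → mismatch g (y ∧ not s) ≤ mismatch g y
mismatch-∖-disjoint g true  y     s⇒¬g rewrite s⇒¬g refl | Bool.∧-zeroʳ y = z≤n
mismatch-∖-disjoint g false y     _    rewrite Bool.∧-identityʳ y = ≤-refl

mismatch-∨ : ∀ {g} s e y → g ≡ s ∨ e → mismatch g y ≤ ⟦ e ⟧ + mismatch s y
mismatch-∨ true  e     true  refl = z≤n
mismatch-∨ true  e     false refl = m≤n+m 1 ⟦ e ⟧
mismatch-∨ false true  true  refl = z≤n
mismatch-∨ false true  false refl = s≤s z≤n
mismatch-∨ false false y     refl = ≤-refl

mismatch-∨-self : ∀ {g} s e → g ≡ s ∨ e → mismatch g s ≤ ⟦ e ⟧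
mismatch-∨-self true  e     refl = z≤n
mismatch-∨-self false true  refl = ≤-refl
mismatch-∨-self false false refl = z≤n

mismatch-∩-sister : ∀ {g} s e y → g ≡ s ∨ e → (e ≡ true → s ≡ false) →
                    ⟦ y ∧ not s ⟧ + mismatch g (y ∧ s) ≤ when e 2 + mismatch g y
mismatch-∩-sister true  true  y     refl e⇒¬s with e⇒¬s refl
... | ()
mismatch-∩-sister true  false true  refl _ = z≤n
mismatch-∩-sister true  false false refl _ = s≤s z≤n
mismatch-∩-sister false true  true  refl _ = s≤s (s≤s z≤n)
mismatch-∩-sister false true  false refl _ = s≤s z≤n
mismatch-∩-sister false false true  refl _ = s≤s z≤n
mismatch-∩-sister false false false refl _ = z≤n

mismatch-∩-outside : ∀ {g} s e y → g ≡ s ∨ e → (e ≡ true → y ≡ false) →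
                     mismatch g (y ∧ s) ≤ mismatch g y
mismatch-∩-outside s     e     false _    _    = ≤-refl
mismatch-∩-outside true  e     true  refl _    = ≤-refl
mismatch-∩-outside false true  true  refl e⇒¬y with e⇒¬y refl
... | ()
mismatch-∩-outside false false true  refl _    = z≤n

⟦∩⟧≤mismatch : ∀ {s' b} s y → (s ≡ true → s' ≡ true) → (y ≡ true → b ≡ false) →
               ⟦ y ∧ s ⟧ ≤ mismatch s' b
⟦∩⟧≤mismatch false y     _    _    rewrite Bool.∧-zeroʳ y = z≤n
⟦∩⟧≤mismatch true  false _    _    = z≤n
⟦∩⟧≤mismatch true  true  s⇒s' y⇒¬b rewrite s⇒s' refl | y⇒¬b refl = ≤-refl

-- Biclusterings as matrices

module _ {n m : ℕ} where

  rowCost : BipGraph n m → BipGraph n m → Fin n → ℕ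
  rowCost G B x = hamming (G x) (B x)

  totalCost : BipGraph n m → BipGraph n m → ℕ
  totalCost G B = sum (rowCost G B)

  IsBiclusterMatrix : BipGraph n m → Set
  IsBiclusterMatrix B = ∀ x x' y y' → B x y ≡ true → B x' y ≡ true → B x y' ≡ B x' y'

meeting-rows-agree : ∀ {n m} {B : BipGraph n m} → IsBiclusterMatrix B →
                     ∀ x x' → meets (B x) (B x') ≡ true → ∀ y → B x y ≡ B x' y
meeting-rows-agree isB x x' meet y with meets-witness meet
... | y₀ , Bxy₀ , Bx'y₀ = isB x x' y₀ y Bxy₀ Bx'y₀

IsBiclusterMatrix-reindex : ∀ {n m} {B : BipGraph n m} → IsBiclusterMatrix B →
                            (c : Fin n → Fin n) → IsBiclusterMatrix (λ x → B (c x))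
IsBiclusterMatrix-reindex isB c x x' = isB (c x) (c x')

listSum-tabulate : ∀ {n} (f : Fin n → ℕ) → List.sum (tabulate f) ≡ sum f
listSum-tabulate {zero}  f = refl
listSum-tabulate {suc n} f = cong (f zero +_) (listSum-tabulate (f ∘ suc))

listSum-allFin : ∀ {n} (f : Fin n → ℕ) → List.sum (map f (allFin n)) ≡ sum f
listSum-allFin f = trans (cong List.sum (map-tabulate (λ i → i) f)) (listSum-tabulate f)

module _ {n m : ℕ} where

  cost≡totalCost : (G B : BipGraph n m) → cost G B ≡ totalCost G B
  cost≡totalCost G B =
    trans (cong List.sum (map-cong (λ x → listSum-allFin (λ y → mismatch (G x y) (B x y))) (allFin n)))
          (listSum-allFin (rowCost G B))

  isBiclusterMatrix : (B : BipGraph n m) → IsBiclusterGraph B → IsBiclusterMatrix B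
  isBiclusterMatrix B biclusters x x' y y' Bxy Bx'y = Bool.⇔→≡ (mk⇔ via-x via-x')
    where
    x~x' : Reach B (inj₁ x) (inj₁ x')
    x~x' = step {w = inj₂ y} (step {w = inj₁ x} (here _) Bxy) Bx'y
    rowOf : ∀ {z} → Reach B (inj₁ x) (inj₁ z) → B z y' ≡ true ⇔ Reach B (inj₁ x) (inj₂ y')
    rowOf {z} x~z = proj₁ (biclusters (inj₁ x)) z y' x~z
    via-x : B x y' ≡ true → B x' y' ≡ true
    via-x = Equivalence.from (rowOf x~x') ∘ Equivalence.to (rowOf (here _))
    via-x' : B x' y' ≡ true → B x y' ≡ true
    via-x' = Equivalence.from (rowOf (here _)) ∘ Equivalence.to (rowOf x~x')

  -- Joined by an edge, or equal or with a common neighbour; for a bicluster matrix this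
  -- relation is closed under further steps, so it contains Reach.
  Linked : BipGraph n m → Vertex n m → Vertex n m → Set
  Linked B (inj₁ x) (inj₁ x') = x ≡ x' ⊎ ∃[ y ] B x y ≡ true × B x' y ≡ true
  Linked B (inj₁ x) (inj₂ y)  = B x y ≡ true
  Linked B (inj₂ y) (inj₁ x)  = B x y ≡ true
  Linked B (inj₂ y) (inj₂ y') = y ≡ y' ⊎ ∃[ x ] B x y ≡ true × B x y' ≡ true

  module _ (B : BipGraph n m) (isB : IsBiclusterMatrix B) where

    Linked-refl : ∀ u → Linked B u u
    Linked-refl (inj₁ x) = inj₁ refl
    Linked-refl (inj₂ y) = inj₁ refl

    Linked-step : ∀ u w z → Linked B u w → adj B w z ≡ true → Linked B u z
    Linked-step (inj₁ x₀) (inj₁ x) (inj₂ y) (inj₁ refl)            Bxy = Bxy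
    Linked-step (inj₁ x₀) (inj₁ x) (inj₂ y) (inj₂ (y₁ , B₀ , B₁)) Bxy = trans (isB x₀ x y₁ y B₀ B₁) Bxy
    Linked-step (inj₁ x₀) (inj₂ y) (inj₁ x) B₀                     Bxy = inj₂ (y , B₀ , Bxy)
    Linked-step (inj₂ y₀) (inj₁ x) (inj₂ y) B₀                     Bxy = inj₂ (x , B₀ , Bxy)
    Linked-step (inj₂ y₀) (inj₂ y) (inj₁ x) (inj₁ refl)            Bxy = Bxy
    Linked-step (inj₂ y₀) (inj₂ y) (inj₁ x) (inj₂ (x₁ , B₀ , B₁)) Bxy = trans (sym (isB x₁ x y y₀ B₁ Bxy)) B₀
    Linked-step u (inj₁ x) (inj₁ x') _ ()
    Linked-step u (inj₂ y) (inj₂ y') _ ()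

    Reach⇒Linked : ∀ {u w} → Reach B u w → Linked B u w
    Reach⇒Linked (here u)                    = Linked-refl u
    Reach⇒Linked (step {u} {w} {z} u~w wz) = Linked-step u w z (Reach⇒Linked u~w) wz

    Linked⇒adjacent : ∀ u x y → Linked B u (inj₁ x) → Linked B u (inj₂ y) → B x y ≡ true
    Linked⇒adjacent (inj₁ x₀) x y (inj₁ refl)            B₀y = B₀y
    Linked⇒adjacent (inj₁ x₀) x y (inj₂ (y₁ , B₀ , B₁)) B₀y = trans (sym (isB x₀ x y₁ y B₀ B₁)) B₀y
    Linked⇒adjacent (inj₂ y₀) x y Bx₀ (inj₁ refl)            = Bx₀
    Linked⇒adjacent (inj₂ y₀) x y Bx₀ (inj₂ (x₁ , B₀ , B₁)) = trans (isB x x₁ y₀ y Bx₀ B₀) B₁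

    isBiclusterGraph : IsBiclusterGraph B
    isBiclusterGraph u =
        (λ x y u~x → mk⇔ (step u~x) (λ u~y → Linked⇒adjacent u x y (Reach⇒Linked u~x) (Reach⇒Linked u~y)))
      , (λ x y u~y → mk⇔ (step u~y) (λ u~x → Linked⇒adjacent u x y (Reach⇒Linked u~x) (Reach⇒Linked u~y)))

deleteEntry : ∀ {n m} → BipGraph n m → Fin n → Fin m → BipGraph n m
deleteEntry G x₀ y₀ x y = G x y ∧ not (x ≡ᵇ x₀ ∧ y ≡ᵇ y₀)

mismatch-∧-not : ∀ g b e → mismatch g b ≤ mismatch (g ∧ not e) b + ⟦ e ⟧
mismatch-∧-not true  true  true  = z≤n
mismatch-∧-not true  false true  = s≤s z≤n
mismatch-∧-not false true  true  = s≤s z≤n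
mismatch-∧-not false false true  = z≤n
mismatch-∧-not true  true  false = z≤n
mismatch-∧-not true  false false = s≤s z≤n
mismatch-∧-not false true  false = s≤s z≤n
mismatch-∧-not false false false = z≤n

mismatch-∧-not-≡ : ∀ g b e → (e ≡ true → g ≡ true × b ≡ false) →
                   mismatch g b ≡ mismatch (g ∧ not e) b + ⟦ e ⟧
mismatch-∧-not-≡ g     b     true  e⇒ with e⇒ refl
... | refl , refl = refl
mismatch-∧-not-≡ true  true  false _  = refl
mismatch-∧-not-≡ true  false false _  = refl
mismatch-∧-not-≡ false true  false _  = refl
mismatch-∧-not-≡ false false false _  = refl

module _ {n m : ℕ} (G : BipGraph n m) (x₀ : Fin n) (y₀ : Fin m) where

  private
    at : Fin n → Fin m → Bool
    at x y = x ≡ᵇ x₀ ∧ y ≡ᵇ y₀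

    count-at : sum (λ x → count (at x)) ≡ 1
    count-at = trans (sum-cong-≗ row) (count-≡ᵇ x₀)
      where
      row : ∀ x → count (at x) ≡ ⟦ x ≡ᵇ x₀ ⟧
      row x with x ≡ᵇ x₀
      ... | true  = count-≡ᵇ y₀
      ... | false = sum-zero m

    sum-mismatch+at : ∀ B → sum (λ x → sum (λ y → mismatch (deleteEntry G x₀ y₀ x y) (B x y) + ⟦ at x y ⟧))
                            ≡ totalCost (deleteEntry G x₀ y₀) B + 1
    sum-mismatch+at B = begin
      sum (λ x → sum (λ y → mismatch (deleteEntry G x₀ y₀ x y) (B x y) + ⟦ at x y ⟧))
        ≡⟨ sum-cong-≗ (λ x → ∑-distrib-+ (λ y → mismatch (deleteEntry G x₀ y₀ x y) (B x y)) (λ y → ⟦ at x y ⟧)) ⟩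
      sum (λ x → rowCost (deleteEntry G x₀ y₀) B x + count (at x))
        ≡⟨ ∑-distrib-+ (rowCost (deleteEntry G x₀ y₀) B) (λ x → count (at x)) ⟩
      totalCost (deleteEntry G x₀ y₀) B + sum (λ x → count (at x))
        ≡⟨ cong (totalCost (deleteEntry G x₀ y₀) B +_) count-at ⟩
      totalCost (deleteEntry G x₀ y₀) B + 1 ∎
      where open ≡-Reasoning

  totalCost-deleteEntry : ∀ B → totalCost G B ≤ totalCost (deleteEntry G x₀ y₀) B + 1
  totalCost-deleteEntry B =
    ≤-trans (sum-mono-≤ λ x → sum-mono-≤ λ y → mismatch-∧-not (G x y) (B x y) (at x y))
            (≤-reflexive (sum-mismatch+at B))

  totalCost-deleteEntry-≡ : G x₀ y₀ ≡ true → ∀ B → B x₀ y₀ ≡ false →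
                            totalCost G B ≡ totalCost (deleteEntry G x₀ y₀) B + 1
  totalCost-deleteEntry-≡ Gx₀y₀ B Bx₀y₀ =
    trans (sum-cong-≗ λ x → sum-cong-≗ λ y → mismatch-∧-not-≡ (G x y) (B x y) (at x y) (at⇒ x y))
          (sum-mismatch+at B)
    where
    at⇒ : ∀ x y → at x y ≡ true → G x y ≡ true × B x y ≡ false
    at⇒ x y at≡true with x ≟ x₀ | y ≟ y₀
    at⇒ x y ()      | no _     | _
    at⇒ x y ()      | yes _    | no _
    ... | yes refl | yes refl = Gx₀y₀ , Bx₀y₀

module _ {n m : ℕ} (G : BipGraph n m) (t : Fin n) (v : Fin m) where

  EntryAvoidable : Set
  EntryAvoidable = ∀ B → IsBiclusterMatrix B →
    ∃[ B' ] IsBiclusterMatrix B' × B' t v ≡ false × totalCost G B' ≤ totalCost G B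

  hasBiclustering-deleteEntry : ∀ {k} → 1 ≤ k → G t v ≡ true → EntryAvoidable →
    HasBiclustering G k ⇔ HasBiclustering (deleteEntry G t v) (k ∸ 1)
  hasBiclustering-deleteEntry {k} 1≤k Gtv avoid = mk⇔ delete restore
    where
    G' : BipGraph n m
    G' = deleteEntry G t v

    delete : HasBiclustering G k → HasBiclustering G' (k ∸ 1)
    delete (B , isB , cost≤k) with avoid B (isBiclusterMatrix B isB)
    ... | B' , isB' , B'tv , B'≤B = B' , isBiclusterGraph B' isB' , m+n≤o⇒m≤o∸n (cost G' B') (begin
      cost G' B' + 1       ≡⟨ cong (_+ 1) (cost≡totalCost G' B') ⟩
      totalCost G' B' + 1  ≡⟨ totalCost-deleteEntry-≡ G t v Gtv B' B'tv ⟨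
      totalCost G B'       ≤⟨ B'≤B ⟩
      totalCost G B        ≡⟨ cost≡totalCost G B ⟨
      cost G B             ≤⟨ cost≤k ⟩
      k                    ∎)
      where open ≤-Reasoning

    restore : HasBiclustering G' (k ∸ 1) → HasBiclustering G k
    restore (B , isB , cost≤k-1) = B , isB , (begin
      cost G B              ≡⟨ cost≡totalCost G B ⟩
      totalCost G B         ≤⟨ totalCost-deleteEntry G t v B ⟩
      totalCost G' B + 1    ≡⟨ cong (_+ 1) (cost≡totalCost G' B) ⟨
      cost G' B + 1         ≤⟨ +-monoˡ-≤ 1 cost≤k-1 ⟩
      k ∸ 1 + 1             ≡⟨ m∸n+n≡m 1≤k ⟩
      k                     ∎)
      where open ≤-Reasoning

-- The exchange argument

-- Rows are the side of R: R is the twin class of r, S = G r = N(R), N is the set of rows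
-- meeting S (that is, N(S)) and T the set of sisters.  The conjuncts of W = N(S) ∖ (R ∪ T) are
-- ordered so that case splits on R and T compute.
module SisterReduction
  {n m : ℕ} (G : BipGraph n m) (r : Fin n) (R T N : Fin n → Bool)
  (r∈R        : R r ≡ true)
  (R-row      : ∀ x → R x ≡ true → ∀ y → G x y ≡ G r y)
  (N-witness  : ∀ x → N x ≡ true → ∃[ y ] G r y ≡ true × G x y ≡ true)
  (N-complete : ∀ x y → N x ≡ false → G r y ≡ true → G x y ≡ false)
  (T⇒¬R       : ∀ x → T x ≡ true → R x ≡ false)
  (T⇒N        : ∀ x → T x ≡ true → N x ≡ true)
  (T-row      : ∀ x → T x ≡ true → ∃[ v' ] G r v' ≡ false × (∀ y → G x y ≡ (G r y ∨ y ≡ᵇ v')))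
  (T-twinless : ∀ x → T x ≡ true → ∀ u → (∀ y → G u y ≡ G x y) → u ≡ x)
  (|W|<|R|    : count (λ x → not (R x) ∧ not (T x) ∧ N x) < count R)
  (t : Fin n) (v : Fin m) (t∈T : T t ≡ true) (v∉S : G r v ≡ false) (Gtv : G t v ≡ true)
  where

  S : Fin m → Bool
  S = G r

  W : Fin n → Bool
  W x = not (R x) ∧ not (T x) ∧ N x

  t∉R : R t ≡ false
  t∉R = T⇒¬R t t∈T

  t∈N : N t ≡ true
  t∈N = T⇒N t t∈T

  t-row : ∀ y → G t y ≡ (S y ∨ y ≡ᵇ v)
  t-row with T-row t t∈T
  ... | v' , v'∉S , row = subst (λ w → ∀ y → G t y ≡ (S y ∨ y ≡ᵇ w)) (sym v≡v') row
    where
    v≡v' : v ≡ v'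
    v≡v' = ≡ᵇ⇒≡ (sym (subst (λ b → true ≡ (b ∨ v ≡ᵇ v')) v∉S (trans (sym Gtv) (row v))))

  Avoiding : BipGraph n m → Set
  Avoiding B = ∃[ B' ] IsBiclusterMatrix B' × B' t v ≡ false × totalCost G B' ≤ totalCost G B

  module Avoid (B : BipGraph n m) (isB : IsBiclusterMatrix B) where

    d : Fin n → ℕ
    d = rowCost G B

    private
      cheapest : ∃[ j ] R j ≡ true × (∀ k → R k ≡ true → d j ≤ d k)
      cheapest = minimiser R d r r∈R

    r* : Fin n
    r* = proj₁ cheapest

    r*∈R : R r* ≡ true
    r*∈R = proj₁ (proj₂ cheapest)

    r*-cheapest : ∀ x → R x ≡ true → d r* ≤ d x
    r*-cheapest = proj₂ (proj₂ cheapest)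

    q : ℕ
    q = d r*

    Y : Fin m → Bool
    Y = B r*

    hamming-S-Y : hamming S Y ≡ q
    hamming-S-Y = sum-cong-≗ λ y → cong (λ g → mismatch g (Y y)) (sym (R-row r* r*∈R y))

    hamming-R-row : ∀ x → R x ≡ true → (P : Fin m → Bool) → hamming (G x) P ≡ hamming S P
    hamming-R-row x x∈R P = sum-cong-≗ λ y → cong (λ g → mismatch g (P y)) (R-row x x∈R y)

    module WhenYContainsV (Btv : B t v ≡ true) (Yv : Y v ≡ true) where

      inY : Fin n → Bool
      inY x = meets (B x) Y

      inY⇒row≡Y : ∀ x → inY x ≡ true → ∀ y → B x y ≡ Y y
      inY⇒row≡Y x = meeting-rows-agree isB x r*

      t-inY : inY t ≡ true
      t-inY = meets-intro {P = B t} {Q = Y} v (cong₂ _∧_ Btv Yv)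

      newRow : Bool → Bool → Bool → (Fin m → Bool) → Fin m → Bool
      newRow true  _     _     _   = Y ∩ S
      newRow false true  true  _   = Y ∩ S
      newRow false true  false _   = Y ∖ S
      newRow false false _     row = row

      B' : BipGraph n m
      B' x = newRow (R x) (inY x) (N x) (B x)

      shape : ∀ x → (B' x ≗ Y ∩ S) ⊎ (B' x ≗ Y ∖ S) ⊎ (inY x ≡ false × B' x ≗ B x)
      shape x with R x | inY x | N x
      ... | true  | _     | _     = inj₁ λ _ → refl
      ... | false | true  | true  = inj₁ λ _ → refl
      ... | false | true  | false = inj₂ (inj₁ λ _ → refl)
      ... | false | false | _     = inj₂ (inj₂ (refl , λ _ → refl))

      private
        ∩-∖-disjoint : ∀ y → (Y ∩ S) y ≡ true → (Y ∖ S) y ≡ true → ⊥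
        ∩-∖-disjoint y with Y y | S y
        ... | true  | true  = λ _ ()
        ... | true  | false = λ ()
        ... | false | _     = λ ()

        outside-misses-Y : ∀ x y → inY x ≡ false → B x y ≡ true → (Y ∩ S) y ≡ true ⊎ (Y ∖ S) y ≡ true → ⊥
        outside-misses-Y x y Mx Bxy Y∩Sy⊎Y∖Sy with meets-false {P = B x} {Q = Y} Mx y Bxy | Y∩Sy⊎Y∖Sy
        ... | ¬Yy | inj₁ Yy = Bool.not-¬ ¬Yy (proj₁ (∧≡true⇒ {Y y} Yy))
        ... | ¬Yy | inj₂ Yy = Bool.not-¬ ¬Yy (proj₁ (∧≡true⇒ {Y y} Yy))

      isB' : IsBiclusterMatrix B'
      isB' x x' y y' B'xy B'x'y with shape x | shape x'
      ... | inj₁ e | inj₁ e' = trans (e y') (sym (e' y'))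
      ... | inj₂ (inj₁ e) | inj₂ (inj₁ e') = trans (e y') (sym (e' y'))
      ... | inj₁ e | inj₂ (inj₁ e') = ⊥-elim (∩-∖-disjoint y (trans (sym (e y)) B'xy) (trans (sym (e' y)) B'x'y))
      ... | inj₂ (inj₁ e) | inj₁ e' = ⊥-elim (∩-∖-disjoint y (trans (sym (e' y)) B'x'y) (trans (sym (e y)) B'xy))
      ... | inj₂ (inj₂ (_ , e)) | inj₂ (inj₂ (_ , e')) =
        trans (e y') (trans (isB x x' y y' (trans (sym (e y)) B'xy) (trans (sym (e' y)) B'x'y)) (sym (e' y')))
      ... | inj₁ e | inj₂ (inj₂ (Mx' , e')) =
        ⊥-elim (outside-misses-Y x' y Mx' (trans (sym (e' y)) B'x'y) (inj₁ (trans (sym (e y)) B'xy)))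
      ... | inj₂ (inj₁ e) | inj₂ (inj₂ (Mx' , e')) =
        ⊥-elim (outside-misses-Y x' y Mx' (trans (sym (e' y)) B'x'y) (inj₂ (trans (sym (e y)) B'xy)))
      ... | inj₂ (inj₂ (Mx , e)) | inj₁ e' =
        ⊥-elim (outside-misses-Y x y Mx (trans (sym (e y)) B'xy) (inj₁ (trans (sym (e' y)) B'x'y)))
      ... | inj₂ (inj₂ (Mx , e)) | inj₂ (inj₁ e') =
        ⊥-elim (outside-misses-Y x y Mx (trans (sym (e y)) B'xy) (inj₂ (trans (sym (e' y)) B'x'y)))

      a : ℕ
      a = count (Y ∖ S)

      1≤a : 1 ≤ a
      1≤a = subst (_≤ a) (cong₂ (λ p q → ⟦ p ∧ not q ⟧) Yv v∉S) (term≤sum (λ y → ⟦ (Y ∖ S) y ⟧) v)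

      inY⇒cost : ∀ x → inY x ≡ true → hamming (G x) Y ≡ d x
      inY⇒cost x Mx = sum-cong-≗ λ y → cong (mismatch (G x y)) (sym (inY⇒row≡Y x Mx y))

      R-cost : ∀ x → R x ≡ true → a + hamming (G x) (Y ∩ S) ≤ d x
      R-cost x x∈R = begin
        a + hamming (G x) (Y ∩ S)
          ≡⟨ cong (a +_) (hamming-R-row x x∈R (Y ∩ S)) ⟩
        a + hamming S (Y ∩ S)
          ≡⟨ ∑-distrib-+ (λ y → ⟦ (Y ∖ S) y ⟧) (λ y → mismatch (S y) ((Y ∩ S) y)) ⟨
        sum (λ y → ⟦ (Y ∖ S) y ⟧ + mismatch (S y) ((Y ∩ S) y))
          ≡⟨ sum-cong-≗ (λ y → mismatch-∩-split (S y) (Y y)) ⟩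
        hamming S Y
          ≡⟨ hamming-S-Y ⟩
        q
          ≤⟨ r*-cheapest x x∈R ⟩
        d x ∎
        where open ≤-Reasoning

      sister-cost : ∀ x v' → inY x ≡ true → S v' ≡ false → (∀ y → G x y ≡ (S y ∨ y ≡ᵇ v')) →
                    a + hamming (G x) (Y ∩ S) ≤ 2 + d x
      sister-cost x v' Mx v'∉S row = begin
        a + hamming (G x) (Y ∩ S)
          ≡⟨ ∑-distrib-+ (λ y → ⟦ (Y ∖ S) y ⟧) (λ y → mismatch (G x y) ((Y ∩ S) y)) ⟨
        sum (λ y → ⟦ (Y ∖ S) y ⟧ + mismatch (G x y) ((Y ∩ S) y))
          ≤⟨ sum-mono-≤ (λ y → mismatch-∩-sister (S y) (y ≡ᵇ v') (Y y) (row y)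
                                 (λ y≡v' → trans (cong S (≡ᵇ⇒≡ y≡v')) v'∉S)) ⟩
        sum (λ y → when (y ≡ᵇ v') 2 + mismatch (G x y) (Y y))
          ≡⟨ sum-when-+ (_≡ᵇ v') 2 (λ y → mismatch (G x y) (Y y)) ⟩
        2 * count (_≡ᵇ v') + hamming (G x) Y
          ≡⟨ cong₂ (λ c h → 2 * c + h) (count-≡ᵇ v') (inY⇒cost x Mx) ⟩
        2 + d x ∎
        where open ≤-Reasoning

      other-sister-cost : ∀ x → x ≢ t → T x ≡ true → inY x ≡ true → hamming (G x) (Y ∩ S) ≤ d x
      other-sister-cost x x≢t x∈T Mx with T-row x x∈T
      ... | v' , v'∉S , row with Y v' in Yv'
      ...   | true  = +-cancelˡ-≤ 2 _ _ (≤-trans (+-monoˡ-≤ _ 2≤a) (sister-cost x v' Mx v'∉S row))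
        where
        v≢v' : v ≢ v'
        v≢v' refl = x≢t (T-twinless t t∈T x λ y → trans (row y) (sym (t-row y)))
        2≤a : 2 ≤ a
        2≤a = subst (_≤ a) (cong₂ _+_ (cong₂ (λ p q → ⟦ p ∧ not q ⟧) Yv v∉S)
                                      (cong₂ (λ p q → ⟦ p ∧ not q ⟧) Yv' v'∉S))
                    (term+term≤sum (λ y → ⟦ (Y ∖ S) y ⟧) v≢v')
      ...   | false = ≤-trans (sum-mono-≤ λ y → mismatch-∩-outside (S y) (y ≡ᵇ v') (Y y) (row y)
                                                  (λ y≡v' → trans (cong Y (≡ᵇ⇒≡ y≡v')) Yv'))
                              (≤-reflexive (inY⇒cost x Mx))

      W-cost : ∀ x → inY x ≡ true → hamming (G x) (Y ∩ S) ≤ a + d x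
      W-cost x Mx = begin
        hamming (G x) (Y ∩ S)
          ≤⟨ sum-mono-≤ (λ y → mismatch-∩ (G x y) (S y) (Y y)) ⟩
        sum (λ y → ⟦ (Y ∖ S) y ⟧ + mismatch (G x y) (Y y))
          ≡⟨ ∑-distrib-+ (λ y → ⟦ (Y ∖ S) y ⟧) (λ y → mismatch (G x y) (Y y)) ⟩
        a + hamming (G x) Y
          ≡⟨ cong (a +_) (inY⇒cost x Mx) ⟩
        a + d x ∎
        where open ≤-Reasoning

      outside-N-cost : ∀ x → inY x ≡ true → N x ≡ false → hamming (G x) (Y ∖ S) ≤ d x
      outside-N-cost x Mx x∉N =
        ≤-trans (sum-mono-≤ λ y → mismatch-∖-disjoint (G x y) (S y) (Y y) (N-complete x y x∉N))
                (≤-reflexive (inY⇒cost x Mx))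

      accounting : ∀ x → when (x ≡ᵇ t) a + (when (R x) a + rowCost G B' x)
                       ≤ when (x ≡ᵇ t) 2 + (when (W x) a + d x)
      accounting x with x ≡ᵇ t in x≡ᵇt
      ... | true with ≡ᵇ⇒≡ {i = x} {j = t} x≡ᵇt
      ...   | refl rewrite t∉R | t-inY | t∈N | t∈T = sister-cost t v t-inY v∉S t-row
      accounting x | false with R x in x∈R | inY x in Mx | N x in x∈N | T x in x∈T
      ... | true  | _     | _     | _     = R-cost x x∈R
      ... | false | false | _     | _     = m≤n+m (d x) _
      ... | false | true  | false | _     = ≤-trans (outside-N-cost x Mx x∈N) (m≤n+m (d x) _)
      ... | false | true  | true  | true  = ≤-trans (other-sister-cost x x≢t x∈T Mx) (m≤n+m (d x) _)
        where
        x≢t : x ≢ t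
        x≢t refl = Bool.not-¬ x≡ᵇt (≡ᵇ-refl x)
      ... | false | true  | true  | false = W-cost x Mx

      B'tv : B' t v ≡ false
      B'tv rewrite t∉R | t-inY | t∈N | Yv | v∉S = refl

      avoiding : Avoiding B
      avoiding = B' , isB' , B'tv , weighted-cancel a a 2 (totalCost G B) (totalCost G B') (+-mono-≤ 1≤a 1≤a) |W|<|R| (begin
        a + (a * count R + totalCost G B')
          ≡⟨ cong (λ c → c + (a * count R + totalCost G B')) (trans (sym (*-identityʳ a)) (cong (a *_) (sym (count-≡ᵇ t)))) ⟩
        a * count (_≡ᵇ t) + (a * count R + totalCost G B')
          ≡⟨ sum-when-when-+ (_≡ᵇ t) R a a (rowCost G B') ⟨
        sum (λ x → when (x ≡ᵇ t) a + (when (R x) a + rowCost G B' x))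
          ≤⟨ sum-mono-≤ accounting ⟩
        sum (λ x → when (x ≡ᵇ t) 2 + (when (W x) a + d x))
          ≡⟨ sum-when-when-+ (_≡ᵇ t) W 2 a d ⟩
        2 * count (_≡ᵇ t) + (a * count W + totalCost G B)
          ≡⟨ cong (λ c → 2 * c + (a * count W + totalCost G B)) (count-≡ᵇ t) ⟩
        2 + (a * count W + totalCost G B) ∎)
        where open ≤-Reasoning

    module WhenTCostsMore (Yv : Y v ≡ false) (q<dt : q < d t) where

      source : Fin n → Fin n
      source x = if x ≡ᵇ t then r* else x

      B' : BipGraph n m
      B' x = B (source x)

      t-cost : hamming (G t) Y ≤ d t
      t-cost = begin
        hamming (G t) Y
          ≤⟨ sum-mono-≤ (λ y → mismatch-∨ (S y) (y ≡ᵇ v) (Y y) (t-row y)) ⟩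
        sum (λ y → ⟦ y ≡ᵇ v ⟧ + mismatch (S y) (Y y))
          ≡⟨ ∑-distrib-+ (λ y → ⟦ y ≡ᵇ v ⟧) (λ y → mismatch (S y) (Y y)) ⟩
        count (_≡ᵇ v) + hamming S Y
          ≡⟨ cong₂ _+_ (count-≡ᵇ v) hamming-S-Y ⟩
        suc q
          ≤⟨ q<dt ⟩
        d t ∎
        where open ≤-Reasoning

      row-cost : ∀ x → rowCost G B' x ≤ d x
      row-cost x with x ≡ᵇ t in x≡ᵇt
      ... | false = ≤-refl
      ... | true with ≡ᵇ⇒≡ {i = x} {j = t} x≡ᵇt
      ...   | refl = t-cost

      B'tv : B' t v ≡ false
      B'tv rewrite ≡ᵇ-refl t = Yv

      avoiding : Avoiding B
      avoiding = B' , IsBiclusterMatrix-reindex isB source , B'tv , sum-mono-≤ row-cost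

    module WhenTCostsLess (Btv : B t v ≡ true) (Yv : Y v ≡ false) (dt≤q : d t ≤ q) where

      t-row-misses-Y : ∀ y → Y y ≡ true → B t y ≡ false
      t-row-misses-Y y Yy with B t y in Bty
      ... | false = refl
      ... | true  = ⊥-elim (Bool.not-¬ Yv (trans (sym (isB t r* y v Bty Yy)) Btv))

      B' : BipGraph n m
      B' x = if R x ∨ T x then S else B x ∖ S

      isB' : IsBiclusterMatrix B'
      isB' x x' y y' with R x ∨ T x | R x' ∨ T x'
      ... | true  | true  = λ _ _ → refl
      ... | false | false = λ B'xy B'x'y → cong (_∧ not (S y'))
                              (isB x x' y y' (proj₁ (∧≡true⇒ B'xy)) (proj₁ (∧≡true⇒ B'x'y)))
      ... | true  | false = λ Sy B'x'y → ⊥-elim (Bool.not-¬ (proj₂ (∖≡true⇒ {B x' y} B'x'y)) Sy)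
      ... | false | true  = λ B'xy Sy → ⊥-elim (Bool.not-¬ (proj₂ (∖≡true⇒ {B x y} B'xy)) Sy)

      zero-cost⇒row : ∀ x → d x ≡ 0 → ∀ y → G x y ≡ B x y
      zero-cost⇒row x dx≡0 y = mismatch≡0⇒≡ (G x y) (B x y) (sum≡0⇒term≡0 (λ y → mismatch (G x y) (B x y)) dx≡0 y)

      private
        S∩t-row : ∃[ y ] S y ≡ true × G t y ≡ true
        S∩t-row = N-witness t t∈N

      s₀ : Fin m
      s₀ = proj₁ S∩t-row

      s₀∈S : S s₀ ≡ true
      s₀∈S = proj₁ (proj₂ S∩t-row)

      sister-row-⊇S : ∀ x → T x ≡ true → ∀ y → S y ≡ true → G x y ≡ true
      sister-row-⊇S x x∈T y Sy with T-row x x∈T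
      ... | v' , _ , row = trans (row y) (cong (_∨ y ≡ᵇ v') Sy)

      1≤q : 1 ≤ q
      1≤q = n≢0⇒n>0 λ q≡0 → Bool.not-¬ (t-row-misses-Y s₀ (Ys₀ q≡0)) (Bts₀ q≡0)
        where
        Ys₀ : q ≡ 0 → Y s₀ ≡ true
        Ys₀ q≡0 = trans (sym (zero-cost⇒row r* q≡0 s₀)) (trans (R-row r* r*∈R s₀) s₀∈S)
        Bts₀ : q ≡ 0 → B t s₀ ≡ true
        Bts₀ q≡0 = trans (sym (zero-cost⇒row t (n≤0⇒n≡0 (subst (d t ≤_) q≡0 dt≤q)) s₀))
                         (sister-row-⊇S t t∈T s₀ s₀∈S)

      exact-sister : Fin n → Bool
      exact-sister x = T x ∧ (d x ℕ.≡ᵇ 0)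

      at-most-one-exact-sister : count exact-sister ≤ 1
      at-most-one-exact-sister = count≤1 exact-sister same
        where
        same : ∀ x x' → exact-sister x ≡ true → exact-sister x' ≡ true → x ≡ x'
        same x x' free free' with ∧≡true⇒ {T x} free | ∧≡true⇒ {T x'} free'
        ... | x∈T , dx≡0 | x'∈T , dx'≡0 = T-twinless x' x'∈T x λ y → begin
          G x y   ≡⟨ zero-cost⇒row x (≡ᵇ0⇒≡0 dx≡0) y ⟩
          B x y   ≡⟨ isB x x' s₀ y (on-s₀ x x∈T dx≡0) (on-s₀ x' x'∈T dx'≡0) ⟩
          B x' y  ≡⟨ zero-cost⇒row x' (≡ᵇ0⇒≡0 dx'≡0) y ⟨
          G x' y  ∎
          where
          open ≡-Reasoning
          on-s₀ : ∀ z → T z ≡ true → (d z ℕ.≡ᵇ 0) ≡ true → B z s₀ ≡ true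
          on-s₀ z z∈T dz≡0 = trans (sym (zero-cost⇒row z (≡ᵇ0⇒≡0 dz≡0) s₀)) (sister-row-⊇S z z∈T s₀ s₀∈S)

      R-cost : ∀ x → R x ≡ true → q + hamming (G x) S ≤ d x
      R-cost x x∈R = begin
        q + hamming (G x) S ≡⟨ cong (q +_) hamming-S-S ⟩
        q + 0               ≡⟨ +-identityʳ q ⟩
        q                   ≤⟨ r*-cheapest x x∈R ⟩
        d x                 ∎
        where
        open ≤-Reasoning
        hamming-S-S : hamming (G x) S ≡ 0
        hamming-S-S = trans (hamming-R-row x x∈R S) (trans (sum-cong-≗ λ y → mismatch-self (S y)) (sum-zero m))

      sister-cost : ∀ x → T x ≡ true → hamming (G x) S ≤ ⟦ d x ℕ.≡ᵇ 0 ⟧ + d x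
      sister-cost x x∈T with T-row x x∈T
      ... | v' , _ , row = begin
        hamming (G x) S ≤⟨ sum-mono-≤ (λ y → mismatch-∨-self (S y) (y ≡ᵇ v') (row y)) ⟩
        count (_≡ᵇ v')  ≡⟨ count-≡ᵇ v' ⟩
        1               ≤⟨ 1≤⟦≡ᵇ0⟧+ (d x) ⟩
        ⟦ d x ℕ.≡ᵇ 0 ⟧ + d x ∎
        where open ≤-Reasoning

      |row∩S|≤q : ∀ x → count (B x ∩ S) ≤ q
      |row∩S|≤q x with meets (B x) Y in Mx
      ... | true = begin
        count (B x ∩ S) ≡⟨ sum-cong-≗ (λ y → cong (λ b → ⟦ b ∧ S y ⟧) (meeting-rows-agree isB x r* Mx y)) ⟩
        count (Y ∩ S)   ≤⟨ sum-mono-≤ (λ y → ⟦∩⟧≤mismatch (S y) (Y y) (sister-row-⊇S t t∈T y) (t-row-misses-Y y)) ⟩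
        d t             ≤⟨ dt≤q ⟩
        q               ∎
        where open ≤-Reasoning
      ... | false = begin
        count (B x ∩ S) ≤⟨ sum-mono-≤ (λ y → ⟦∩⟧≤mismatch (S y) (B x y) (λ Sy → Sy)
                                                           (meets-false {P = B x} {Q = Y} Mx y)) ⟩
        hamming S Y     ≡⟨ hamming-S-Y ⟩
        q               ∎
        where open ≤-Reasoning

      W-cost : ∀ x → hamming (G x) (B x ∖ S) ≤ q + d x
      W-cost x = begin
        hamming (G x) (B x ∖ S)
          ≤⟨ sum-mono-≤ (λ y → mismatch-∖ (G x y) (S y) (B x y)) ⟩
        sum (λ y → ⟦ (B x ∩ S) y ⟧ + mismatch (G x y) (B x y))
          ≡⟨ ∑-distrib-+ (λ y → ⟦ (B x ∩ S) y ⟧) (λ y → mismatch (G x y) (B x y)) ⟩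
        count (B x ∩ S) + d x
          ≤⟨ +-monoˡ-≤ (d x) (|row∩S|≤q x) ⟩
        q + d x ∎
        where open ≤-Reasoning

      outside-N-cost : ∀ x → N x ≡ false → hamming (G x) (B x ∖ S) ≤ d x
      outside-N-cost x x∉N = sum-mono-≤ λ y → mismatch-∖-disjoint (G x y) (S y) (B x y) (N-complete x y x∉N)

      accounting : ∀ x → when (R x) q + rowCost G B' x
                       ≤ ⟦ exact-sister x ⟧ + (when (W x) q + d x)
      accounting x with R x in x∈R | T x in x∈T | N x in x∈N
      ... | true  | _     | _     = ≤-trans (R-cost x x∈R) (m≤n+m (d x) _)
      ... | false | true  | _     = sister-cost x x∈T
      ... | false | false | true  = W-cost x
      ... | false | false | false = outside-N-cost x x∈N

      B'tv : B' t v ≡ false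
      B'tv rewrite t∉R | t∈T = v∉S

      avoiding : Avoiding B
      avoiding = B' , isB' , B'tv , weighted-cancel q 0 (count exact-sister) (totalCost G B) (totalCost G B')
                                      (≤-trans at-most-one-exact-sister 1≤q) |W|<|R| (begin
        q * count R + totalCost G B'
          ≡⟨ sum-when-+ R q (rowCost G B') ⟨
        sum (λ x → when (R x) q + rowCost G B' x)
          ≤⟨ sum-mono-≤ accounting ⟩
        sum (λ x → when (exact-sister x) 1 + (when (W x) q + d x))
          ≡⟨ sum-when-when-+ exact-sister W 1 q d ⟩
        1 * count exact-sister + (q * count W + totalCost G B)
          ≡⟨ cong (_+ (q * count W + totalCost G B)) (*-identityˡ (count exact-sister)) ⟩
        count exact-sister + (q * count W + totalCost G B) ∎)
        where open ≤-Reasoning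

    avoiding : Avoiding B
    avoiding with B t v in Btv | Y v in Yv | q <? d t
    ... | false | _     | _        = B , isB , Btv , ≤-refl
    ... | true  | true  | _        = WhenYContainsV.avoiding Btv Yv
    ... | true  | false | yes q<dt = WhenTCostsMore.avoiding Yv q<dt
    ... | true  | false | no  q≮dt = WhenTCostsLess.avoiding Btv Yv (≮⇒≥ q≮dt)

  avoid : EntryAvoidable G t v
  avoid B isB = Avoid.avoiding B isB

-- Reading the vertex-level definitions

module _ {n₁ n₂ : ℕ} where

  ∈-vertices : (u : Vertex n₁ n₂) → u ∈ vertices
  ∈-vertices (inj₁ x) = ∈-++⁺ˡ (∈-map⁺ inj₁ (∈-allFin x))
  ∈-vertices (inj₂ y) = ∈-++⁺ʳ (map inj₁ (allFin n₁)) (∈-map⁺ inj₂ (∈-allFin y))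

  any-vertices⁻ : (P : Vertex n₁ n₂ → Bool) → any P vertices ≡ true → ∃[ u ] P u ≡ true
  any-vertices⁻ P any≡true with Any.satisfied (any⁻ P vertices (Equivalence.from Bool.T-≡ any≡true))
  ... | u , Pu = u , Equivalence.to Bool.T-≡ Pu

  any-vertices⁺ : (P : Vertex n₁ n₂ → Bool) (u : Vertex n₁ n₂) → P u ≡ true → any P vertices ≡ true
  any-vertices⁺ P u Pu = Equivalence.to Bool.T-≡ (any⁺ P (lose (∈-vertices u) (Equivalence.from Bool.T-≡ Pu)))

  all-vertices⁻ : (P : Vertex n₁ n₂ → Bool) → all P vertices ≡ true → ∀ u → P u ≡ true
  all-vertices⁻ P all≡true u =
    Equivalence.to Bool.T-≡ (All.lookup (all⁺ P vertices (Equivalence.from Bool.T-≡ all≡true)) (∈-vertices u))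

  all-vertices⁺ : (P : Vertex n₁ n₂ → Bool) → (∀ u → P u ≡ true) → all P vertices ≡ true
  all-vertices⁺ P all-true =
    Equivalence.to Bool.T-≡ (all⁻ P {vertices} (All.tabulate λ {u} _ → Equivalence.from Bool.T-≡ (all-true u)))

  any-cong : {P Q : Vertex n₁ n₂ → Bool} → (∀ u → P u ≡ Q u) → any P vertices ≡ any Q vertices
  any-cong P≗Q = cong or (map-cong P≗Q vertices)

  all-cong : {P Q : Vertex n₁ n₂ → Bool} → (∀ u → P u ≡ Q u) → all P vertices ≡ all Q vertices
  all-cong P≗Q = cong and (map-cong P≗Q vertices)

  card-split : (P : Vertex n₁ n₂ → Bool) → card P ≡ count (λ x → P (inj₁ x)) + count (λ y → P (inj₂ y))
  card-split P = begin
    List.sum (map f (map inj₁ (allFin n₁) ++ map inj₂ (allFin n₂)))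
      ≡⟨ cong List.sum (map-++ f (map inj₁ (allFin n₁)) (map inj₂ (allFin n₂))) ⟩
    List.sum (map f (map inj₁ (allFin n₁)) ++ map f (map inj₂ (allFin n₂)))
      ≡⟨ sum-++ (map f (map inj₁ (allFin n₁))) (map f (map inj₂ (allFin n₂))) ⟩
    List.sum (map f (map inj₁ (allFin n₁))) + List.sum (map f (map inj₂ (allFin n₂)))
      ≡⟨ cong₂ _+_ (trans (cong List.sum (sym (map-∘ (allFin n₁)))) (listSum-allFin (f ∘ inj₁)))
                   (trans (cong List.sum (sym (map-∘ (allFin n₂)))) (listSum-allFin (f ∘ inj₂))) ⟩
    count (λ x → P (inj₁ x)) + count (λ y → P (inj₂ y)) ∎
    where
    open ≡-Reasoning
    f : Vertex n₁ n₂ → ℕ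
    f u = ⟦ P u ⟧

  card-cong : {P Q : Vertex n₁ n₂ → Bool} → (∀ u → P u ≡ Q u) → card P ≡ card Q
  card-cong P≗Q = cong List.sum (map-cong (λ u → cong ⟦_⟧ (P≗Q u)) vertices)

  HasBiclustering-cong : ∀ {H H' : BipGraph n₁ n₂} {k} → (∀ x y → H x y ≡ H' x y) →
                         HasBiclustering H k → HasBiclustering H' k
  HasBiclustering-cong {H} {H'} {k} H≗H' (B , isB , cost≤k) = B , isB , (begin
    cost H' B      ≡⟨ cost≡totalCost H' B ⟩
    totalCost H' B ≡⟨ sum-cong-≗ (λ x → sum-cong-≗ λ y → cong (λ g → mismatch g (B x y)) (H≗H' x y)) ⟨
    totalCost H B  ≡⟨ cost≡totalCost H B ⟨
    cost H B       ≤⟨ cost≤k ⟩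
    k              ∎)
    where open ≤-Reasoning

  ≟V-inj₁ : (a b : Fin n₁) → (_≟V_ {n₁} {n₂} (inj₁ a) (inj₁ b)) ≡ (a ≡ᵇ b)
  ≟V-inj₁ a b with a ≟ b
  ... | yes _ = refl
  ... | no  _ = refl

  ≟V-inj₂ : (a b : Fin n₂) → (_≟V_ {n₁} {n₂} (inj₂ a) (inj₂ b)) ≡ (a ≡ᵇ b)
  ≟V-inj₂ a b with a ≟ b
  ... | yes _ = refl
  ... | no  _ = refl

  ==⇒≡ : ∀ {a b} → _==_ {n₁} {n₂} a b ≡ true → a ≡ b
  ==⇒≡ {true}  {true}  _ = refl
  ==⇒≡ {false} {false} _ = refl

  ==-refl : ∀ a → _==_ {n₁} {n₂} a a ≡ true
  ==-refl true  = refl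
  ==-refl false = refl

module FirstSide {n₁ n₂ : ℕ} (G : BipGraph n₁ n₂) (r₁ : Fin n₁) where

  r : Vertex n₁ n₂
  r = inj₁ r₁

  R T N : Fin n₁ → Bool
  R x = inR G r (inj₁ x)
  T x = inT G r (inj₁ x)
  N x = inNS G r (inj₁ x)

  twin⇒row : ∀ a b → twin G (inj₁ a) (inj₁ b) ≡ true → ∀ y → G a y ≡ G b y
  twin⇒row a b twin-ab y =
    ==⇒≡ {n₁} {n₂} (all-vertices⁻ (λ z → _==_ {n₁} {n₂} (adj G (inj₁ a) z) (adj G (inj₁ b) z)) twin-ab (inj₂ y))

  row⇒twin : ∀ a b → (∀ y → G a y ≡ G b y) → twin G (inj₁ a) (inj₁ b) ≡ true
  row⇒twin a b row = all-vertices⁺ _ same-adj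
    where
    same-adj : ∀ z → _==_ {n₁} {n₂} (adj G (inj₁ a) z) (adj G (inj₁ b) z) ≡ true
    same-adj (inj₁ _) = refl
    same-adj (inj₂ y) = subst (λ c → _==_ {n₁} {n₂} (G a y) c ≡ true) (row y) (==-refl {n₁} {n₂} (G a y))

  r∈R : R r₁ ≡ true
  r∈R = row⇒twin r₁ r₁ λ _ → refl

  R-row : ∀ x → R x ≡ true → ∀ y → G x y ≡ G r₁ y
  R-row x x∈R y = sym (twin⇒row r₁ x x∈R y)

  S-inj₁ : ∀ a → inS G r (inj₁ a) ≡ false
  S-inj₁ a = Bool.¬-not λ S-a → no-edge (any-vertices⁻ _ S-a)
    where
    no-edge : ∄[ u ] (inR G r u ∧ adj G u (inj₁ a)) ≡ true
    no-edge (inj₁ x , Ru∧adj) = Bool.not-¬ (proj₂ (∧≡true⇒ {inR G r (inj₁ x)} Ru∧adj)) refl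
    no-edge (inj₂ y , ())

  S-inj₂ : ∀ y → inS G r (inj₂ y) ≡ G r₁ y
  S-inj₂ y = Bool.⇔→≡ (mk⇔ S⇒ ⇒S)
    where
    S⇒ : inS G r (inj₂ y) ≡ true → G r₁ y ≡ true
    S⇒ S-y with any-vertices⁻ _ S-y
    ... | inj₁ x , Rx∧Gxy with ∧≡true⇒ {inR G r (inj₁ x)} Rx∧Gxy
    ...   | x∈R , Gxy = trans (sym (R-row x x∈R y)) Gxy
    ⇒S : G r₁ y ≡ true → inS G r (inj₂ y) ≡ true
    ⇒S Gry = any-vertices⁺ (λ u → inR G r u ∧ adj G u (inj₂ y)) r (cong₂ _∧_ r∈R Gry)

  N-inj₂ : ∀ y → inNS G r (inj₂ y) ≡ false
  N-inj₂ y = Bool.¬-not λ N-y → no-path (any-vertices⁻ _ N-y)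
    where
    no-path : ∄[ z ] (inS G r z ∧ adj G z (inj₂ y)) ≡ true
    no-path (inj₁ a , Sa∧adj) = Bool.not-¬ (S-inj₁ a) (proj₁ (∧≡true⇒ {inS G r (inj₁ a)} Sa∧adj))
    no-path (inj₂ b , Sb∧adj) = Bool.not-¬ refl (proj₂ (∧≡true⇒ {inS G r (inj₂ b)} Sb∧adj))

  N-witness : ∀ x → N x ≡ true → ∃[ y ] G r₁ y ≡ true × G x y ≡ true
  N-witness x N-x with any-vertices⁻ _ N-x
  ... | inj₁ a , Sa∧adj = ⊥-elim (Bool.not-¬ (S-inj₁ a) (proj₁ (∧≡true⇒ {inS G r (inj₁ a)} Sa∧adj)))
  ... | inj₂ y , Sy∧Gxy with ∧≡true⇒ {inS G r (inj₂ y)} Sy∧Gxy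
  ...   | S-y , Gxy = y , trans (sym (S-inj₂ y)) S-y , Gxy

  N-complete : ∀ x y → N x ≡ false → G r₁ y ≡ true → G x y ≡ false
  N-complete x y x∉N Gry = Bool.¬-not λ Gxy →
    Bool.not-¬ x∉N (any-vertices⁺ (λ z → inS G r z ∧ adj G z (inj₁ x)) (inj₂ y) (cong₂ _∧_ (trans (S-inj₂ y) Gry) Gxy))

  T⇒¬R : ∀ x → T x ≡ true → R x ≡ false
  T⇒¬R x x∈T = Bool.not-injective (proj₁ (∧≡true⇒ (proj₂ (∧≡true⇒ {N x} x∈T))))

  T⇒N : ∀ x → T x ≡ true → N x ≡ true
  T⇒N x x∈T = proj₁ (∧≡true⇒ x∈T)

  private
    sister-parts : ∀ x → T x ≡ true → noTwin G (inj₁ x) ≡ true ×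
      any (λ w → not (inS G r w) ∧ all (λ z → _==_ {n₁} {n₂} (adj G (inj₁ x) z) (inS G r z ∨ (z ≟V w))) vertices)
          vertices ≡ true
    sister-parts x x∈T = ∧≡true⇒ (proj₂ (∧≡true⇒ {not (R x)} (proj₂ (∧≡true⇒ {N x} x∈T))))

  T-row : ∀ x → T x ≡ true → ∃[ v' ] G r₁ v' ≡ false × (∀ y → G x y ≡ (G r₁ y ∨ y ≡ᵇ v'))
  T-row x x∈T with any-vertices⁻ _ (proj₂ (sister-parts x x∈T))
  ... | w , ¬Sw∧row with ∧≡true⇒ {not (inS G r w)} ¬Sw∧row
  ...   | ¬Sw , row = extra w (Bool.not-injective ¬Sw) (all-vertices⁻ _ row)
    where
    extra : ∀ w → inS G r w ≡ false →
            (∀ z → _==_ {n₁} {n₂} (adj G (inj₁ x) z) (inS G r z ∨ (z ≟V w)) ≡ true) →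
            ∃[ v' ] G r₁ v' ≡ false × (∀ y → G x y ≡ (G r₁ y ∨ y ≡ᵇ v'))
    extra (inj₁ a) _ row-w with subst₂ (λ s e → _==_ {n₁} {n₂} false (s ∨ e) ≡ true)
                                        (S-inj₁ a) (trans (≟V-inj₁ a a) (≡ᵇ-refl a)) (row-w (inj₁ a))
    ... | ()
    extra (inj₂ v') v'∉S row-w = v' , trans (sym (S-inj₂ v')) v'∉S ,
      λ y → trans (==⇒≡ {n₁} {n₂} (row-w (inj₂ y))) (cong₂ _∨_ (S-inj₂ y) (≟V-inj₂ y v'))

  T-twinless : ∀ x → T x ≡ true → ∀ u → (∀ y → G u y ≡ G x y) → u ≡ x
  T-twinless x x∈T u row with all-vertices⁻ _ (proj₁ (sister-parts x x∈T)) (inj₁ u)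
  ... | ¬twin∨≡ = ≡ᵇ⇒≡ (trans (sym (≟V-inj₁ u x))
                           (subst (λ b → (not b ∨ (inj₁ u ≟V inj₁ x)) ≡ true) (row⇒twin x u (λ y → sym (row y))) ¬twin∨≡))

  count-R : card (inR G r) ≡ count R
  count-R = trans (card-split (inR G r)) (trans (cong (count R +_) (sum-zero n₂)) (+-identityʳ _))

  count-W : card (inW G r) ≡ count (λ x → not (R x) ∧ not (T x) ∧ N x)
  count-W = begin
    card (inW G r)
      ≡⟨ card-split (inW G r) ⟩
    count (λ x → inW G r (inj₁ x)) + count (λ y → inW G r (inj₂ y))
      ≡⟨ cong₂ _+_ (sum-cong-≗ λ x → cong ⟦_⟧ (trans (Bool.∧-comm (N x) _) (Bool.∧-assoc (not (R x)) (not (T x)) (N x))))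
                   (trans (sum-cong-≗ λ y → cong (λ b → ⟦ b ∧ not (inR G r (inj₂ y)) ∧ not (inT G r (inj₂ y)) ⟧) (N-inj₂ y)) (sum-zero n₂)) ⟩
    count (λ x → not (R x) ∧ not (T x) ∧ N x) + 0
      ≡⟨ +-identityʳ _ ⟩
    count (λ x → not (R x) ∧ not (T x) ∧ N x) ∎
    where open ≡-Reasoning

  deleteEdge≗deleteEntry : ∀ t v x y → deleteEdge G (inj₁ t) (inj₂ v) x y ≡ deleteEntry G t v x y
  deleteEdge≗deleteEntry t v x y =
    cong (λ e → G x y ∧ not e)
         (trans (Bool.∨-identityʳ _) (cong₂ _∧_ (≟V-inj₁ x t) (≟V-inj₂ y v)))

  sister-edge-deletion : ∀ {k} → 1 ≤ k → card (inW G r) < card (inR G r) →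
    (t v : Vertex n₁ n₂) → inT G r t ≡ true → adj G t v ≡ true → inS G r v ≡ false →
    HasBiclustering G k ⇔ HasBiclustering (deleteEdge G t v) (k ∸ 1)
  sister-edge-deletion _ _ (inj₂ b) _ t∈T _ _ = ⊥-elim (Bool.not-¬ (N-inj₂ b) (proj₁ (∧≡true⇒ t∈T)))
  sister-edge-deletion _ _ (inj₁ _) (inj₁ _) _ () _
  sister-edge-deletion {k} 1≤k |W|<|R| (inj₁ t) (inj₂ v) t∈T Gtv v∉S = mk⇔
    (HasBiclustering-cong (λ x y → sym (deleteEdge≗deleteEntry t v x y)) ∘ Equivalence.to deletion)
    (Equivalence.from deletion ∘ HasBiclustering-cong (deleteEdge≗deleteEntry t v))
    where
    avoid : EntryAvoidable G t v
    avoid = SisterReduction.avoid G r₁ R T N r∈R R-row N-witness N-complete T⇒¬R T⇒N T-row T-twinless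
              (subst₂ _<_ count-W count-R |W|<|R|) t v t∈T (trans (sym (S-inj₂ v)) v∉S) Gtv
    deletion : HasBiclustering G k ⇔ HasBiclustering (deleteEntry G t v) (k ∸ 1)
    deletion = hasBiclustering-deleteEntry G t v 1≤k Gtv avoid

-- Transposition

transpose : ∀ {n₁ n₂} → BipGraph n₁ n₂ → BipGraph n₂ n₁
transpose G y x = G x y

IsBiclusterMatrix-transpose : ∀ {n₁ n₂} {B : BipGraph n₁ n₂} → IsBiclusterMatrix B → IsBiclusterMatrix (transpose B)
IsBiclusterMatrix-transpose isB y y' x x' Bxy Bxy' =
  Bool.⇔→≡ (mk⇔ (λ Bx'y → trans (isB x' x y y' Bx'y Bxy) Bxy') (λ Bx'y' → trans (isB x' x y' y Bx'y' Bxy') Bxy))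

HasBiclustering-transpose : ∀ {n₁ n₂} (G : BipGraph n₁ n₂) {k} → HasBiclustering G k → HasBiclustering (transpose G) k
HasBiclustering-transpose G {k} (B , isB , cost≤k) =
  transpose B , isBiclusterGraph (transpose B) (IsBiclusterMatrix-transpose (isBiclusterMatrix B isB)) , (begin
    cost (transpose G) (transpose B)      ≡⟨ cost≡totalCost (transpose G) (transpose B) ⟩
    totalCost (transpose G) (transpose B) ≡⟨ ∑-comm (λ x y → mismatch (G x y) (B x y)) ⟨
    totalCost G B                         ≡⟨ cost≡totalCost G B ⟨
    cost G B                              ≤⟨ cost≤k ⟩
    k                                     ∎)
  where open ≤-Reasoning

module Transposed {n₁ n₂ : ℕ} (G : BipGraph n₁ n₂) where

  Gᵀ : BipGraph n₂ n₁
  Gᵀ = transpose G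

  adj-swap : ∀ u w → adj Gᵀ (swap u) (swap w) ≡ adj G u w
  adj-swap (inj₁ _) (inj₁ _) = refl
  adj-swap (inj₁ _) (inj₂ _) = refl
  adj-swap (inj₂ _) (inj₁ _) = refl
  adj-swap (inj₂ _) (inj₂ _) = refl

  sameSide-swap : ∀ u w → sameSide {n₂} {n₁} (swap u) (swap w) ≡ sameSide {n₁} {n₂} u w
  sameSide-swap (inj₁ _) (inj₁ _) = refl
  sameSide-swap (inj₁ _) (inj₂ _) = refl
  sameSide-swap (inj₂ _) (inj₁ _) = refl
  sameSide-swap (inj₂ _) (inj₂ _) = refl

  ≟V-swap : ∀ u w → (swap u ≟V swap w) ≡ (u ≟V w)
  ≟V-swap (inj₁ a) (inj₁ b) = trans (≟V-inj₂ {n₂} {n₁} a b) (sym (≟V-inj₁ {n₁} {n₂} a b))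
  ≟V-swap (inj₁ _) (inj₂ _) = refl
  ≟V-swap (inj₂ _) (inj₁ _) = refl
  ≟V-swap (inj₂ a) (inj₂ b) = trans (≟V-inj₁ {n₂} {n₁} a b) (sym (≟V-inj₂ {n₁} {n₂} a b))

  any-swap : (P : Vertex n₂ n₁ → Bool) → any P vertices ≡ any (P ∘ swap) vertices
  any-swap P = Bool.⇔→≡ (mk⇔ to from)
    where
    to : any P vertices ≡ true → any (P ∘ swap) vertices ≡ true
    to any-P with any-vertices⁻ P any-P
    ... | u , Pu = any-vertices⁺ (P ∘ swap) (swap u) (subst (λ w → P w ≡ true) (sym (swap-involutive u)) Pu)
    from : any (P ∘ swap) vertices ≡ true → any P vertices ≡ true
    from any-P∘swap with any-vertices⁻ (P ∘ swap) any-P∘swap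
    ... | u , Pswap-u = any-vertices⁺ P (swap u) Pswap-u

  all-swap : (P : Vertex n₂ n₁ → Bool) → all P vertices ≡ all (P ∘ swap) vertices
  all-swap P = Bool.⇔→≡ (mk⇔ to from)
    where
    to : all P vertices ≡ true → all (P ∘ swap) vertices ≡ true
    to all-P = all-vertices⁺ (P ∘ swap) (all-vertices⁻ P all-P ∘ swap)
    from : all (P ∘ swap) vertices ≡ true → all P vertices ≡ true
    from all-P∘swap = all-vertices⁺ P λ u →
      subst (λ w → P w ≡ true) (swap-involutive u) (all-vertices⁻ (P ∘ swap) all-P∘swap (swap u))

  card-swap : (P : Vertex n₂ n₁ → Bool) → card P ≡ card (P ∘ swap)
  card-swap P = trans (card-split P) (trans (+-comm (count (P ∘ inj₁)) (count (P ∘ inj₂))) (sym (card-split (P ∘ swap))))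

  twin-swap : ∀ u w → twin Gᵀ (swap u) (swap w) ≡ twin G u w
  twin-swap u w = cong₂ _∧_ (sameSide-swap u w)
    (trans (all-swap _) (all-cong λ z → cong₂ (_==_ {n₁} {n₂}) (adj-swap u z) (adj-swap w z)))

  inS-swap : ∀ r z → inS Gᵀ (swap r) (swap z) ≡ inS G r z
  inS-swap r z = trans (any-swap _) (any-cong λ x → cong₂ _∧_ (twin-swap r x) (adj-swap x z))

  inNS-swap : ∀ r t → inNS Gᵀ (swap r) (swap t) ≡ inNS G r t
  inNS-swap r t = trans (any-swap _) (any-cong λ z → cong₂ _∧_ (inS-swap r z) (adj-swap z t))

  noTwin-swap : ∀ t → noTwin Gᵀ (swap t) ≡ noTwin G t
  noTwin-swap t = trans (all-swap _) (all-cong λ u → cong₂ (λ a b → not a ∨ b) (twin-swap t u) (≟V-swap u t))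

  inT-swap : ∀ r t → inT Gᵀ (swap r) (swap t) ≡ inT G r t
  inT-swap r t = cong₂ _∧_ (inNS-swap r t) (cong₂ _∧_ (cong not (twin-swap r t)) (cong₂ _∧_ (noTwin-swap t)
    (trans (any-swap _) (any-cong λ v → cong₂ _∧_ (cong not (inS-swap r v))
      (trans (all-swap _) (all-cong λ z → cong₂ (_==_ {n₁} {n₂}) (adj-swap t z) (cong₂ _∨_ (inS-swap r z) (≟V-swap z v))))))))

  inW-swap : ∀ r x → inW Gᵀ (swap r) (swap x) ≡ inW G r x
  inW-swap r x = cong₂ _∧_ (inNS-swap r x) (cong₂ _∧_ (cong not (twin-swap r x)) (cong not (inT-swap r x)))

  deleteEdge-swap : ∀ t v x y → deleteEdge Gᵀ (swap t) (swap v) y x ≡ deleteEdge G t v x y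
  deleteEdge-swap t v x y = cong (λ e → G x y ∧ not e) (begin
    ((swap (inj₂ y) ≟V swap t) ∧ (swap (inj₁ x) ≟V swap v)) ∨ ((swap (inj₂ y) ≟V swap v) ∧ (swap (inj₁ x) ≟V swap t))
      ≡⟨ cong₂ _∨_ (cong₂ _∧_ (≟V-swap (inj₂ y) t) (≟V-swap (inj₁ x) v))
                   (cong₂ _∧_ (≟V-swap (inj₂ y) v) (≟V-swap (inj₁ x) t)) ⟩
    ((inj₂ y ≟V t) ∧ (inj₁ x ≟V v)) ∨ ((inj₂ y ≟V v) ∧ (inj₁ x ≟V t))
      ≡⟨ Bool.∨-comm ((inj₂ y ≟V t) ∧ (inj₁ x ≟V v)) ((inj₂ y ≟V v) ∧ (inj₁ x ≟V t)) ⟩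
    ((inj₂ y ≟V v) ∧ (inj₁ x ≟V t)) ∨ ((inj₂ y ≟V t) ∧ (inj₁ x ≟V v))
      ≡⟨ cong₂ _∨_ (Bool.∧-comm (inj₂ y ≟V v) (inj₁ x ≟V t)) (Bool.∧-comm (inj₂ y ≟V t) (inj₁ x ≟V v)) ⟩
    ((inj₁ x ≟V t) ∧ (inj₂ y ≟V v)) ∨ ((inj₁ x ≟V v) ∧ (inj₂ y ≟V t)) ∎)
    where open ≡-Reasoning

  deleteEdge-equivalence-transpose : ∀ {k k'} t v →
    (HasBiclustering Gᵀ k ⇔ HasBiclustering (deleteEdge Gᵀ (swap t) (swap v)) k') →
    (HasBiclustering G k ⇔ HasBiclustering (deleteEdge G t v) k')
  deleteEdge-equivalence-transpose t v equivᵀ = mk⇔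
    (HasBiclustering-cong (deleteEdge-swap t v) ∘ HasBiclustering-transpose (deleteEdge Gᵀ (swap t) (swap v))
       ∘ Equivalence.to equivᵀ ∘ HasBiclustering-transpose G)
    (HasBiclustering-transpose Gᵀ ∘ Equivalence.from equivᵀ
       ∘ HasBiclustering-cong (λ y x → sym (deleteEdge-swap t v x y)) ∘ HasBiclustering-transpose (deleteEdge G t v))

lemma3 : {n₁ n₂ : ℕ} (G : BipGraph n₁ n₂) (k : ℕ) → 1 ≤ k →
         (r : Vertex n₁ n₂) →
         card (inW G r) < card (inR G r) →
         1 ≤ card (inT G r) →
         (t v : Vertex n₁ n₂) → inT G r t ≡ true →
         adj G t v ≡ true → inS G r v ≡ false →
         (HasBiclustering G k ⇔ HasBiclustering (deleteEdge G t v) (k ∸ 1))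
lemma3 G k 1≤k (inj₁ r₁) |W|<|R| _ = FirstSide.sister-edge-deletion G r₁ 1≤k |W|<|R|
lemma3 G k 1≤k r@(inj₂ r₂) |W|<|R| _ t v t∈T Gtv v∉S =
  deleteEdge-equivalence-transpose t v
    (FirstSide.sister-edge-deletion Gᵀ r₂ 1≤k |W|<|R|ᵀ (swap t) (swap v)
       (trans (inT-swap r t) t∈T) (trans (adj-swap t v) Gtv) (trans (inS-swap r v) v∉S))
  where
  open Transposed G
  |W|<|R|ᵀ : card (inW Gᵀ (swap r)) < card (inR Gᵀ (swap r))
  |W|<|R|ᵀ = subst₂ _<_ (sym (trans (card-swap _) (card-cong (inW-swap r))))
                        (sym (trans (card-swap _) (card-cong (twin-swap r)))) |W|<|R|
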